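{- For every $n \ge 3$, the number $S_n$ of colourability sinks in $\{0,1\}^n$ satisfies $S_n = K_n - 4$, where $K_n$ is the number of non-colourable strings of length $n$.
   Context: Strings are over $\Lambda=\{0,1\}$; $\varepsilon$ is the empty string, $\#w$ the length of $w$. For $\#w\ge 1$ let $l(w)$ be $w$ with its last letter removed and $r(w)$ be $w$ with its first letter removed. Let $T^n$ be the alternating string of length $n$ starting with $0$ ($T^0=\varepsilon$, $T^n=T^{n-1}0$ for odd $n$, $T^n=T^{n-1}1$ for even $n\ge 2$) and $CT^n$ its letterwise complement. Define $\xi:\Lambda^*\to\{ -1,0,1\}$ recursively: $\xi(\varepsilon)=0$; $\xi(w)=1$ if $w=T^k$ with $k\ge 2$ even; $\xi(w)=-1$ if $w=CT^k$ with $k\ge2$ even; otherwise $\xi(w)=\operatorname{sgn}(\xi(l(w))+\xi(r(w)))$. Define $\phi:\Lambda^*\to\{ -1,0,1\}$: $\phi(\varepsilon)=0$; $\phi(w)=-1$ if $w=0^k$, $k$ odd; $\phi(w)=1$ if $w=1^k$, $k$ odd; otherwise $\phi(w)=\operatorname{sgn}(\phi(r(w))-\phi(l(w)))$. Let $\psi(w)=\xi(w)^{\#w}\phi(w)$ (with $0^0=1$); $w$ is colourable iff $\psi(w)\ne0$. $K_n=\#\{w\in\Lambda^n:\psi(w)=0\}$. A string $w$ is a colourability sink if neither $w0$ nor $w1$ is colourable, and a colourability source if neither $0w$ nor $1w$ is colourable. -}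

module Defs where

open import Data.Bool using (Bool; true; false; not; _∧_; if_then_else_)
import Data.Bool as B
open import Data.Nat using (ℕ; zero; suc)
open import Data.Integer using (ℤ; +_; -_; _+_; -[1+_]; _^_)
open import Data.Vec using (Vec; []; _∷_; _∷ʳ_; init; tail; replicate; map)
open import Data.Vec.Properties using (≡-dec)
open import Data.List using (List; length; filter; concatMap)
import Data.List as L
open import Relation.Nullary using (¬_; ¬?; does; Dec; _×-dec_)
open import Data.Product using (_×_)
open import Relation.Binary.PropositionalEquality using (_≡_)
import Data.Integer.Properties as ℤP

Λ : Set
Λ = Bool

𝟘 𝟙 : Λ
𝟘 = false
𝟙 = true

Str : ℕ → Set
Str n = Vec Λ n

isEven : ℕ → Bool
isEven zero = true
isEven (suc n) = not (isEven n)

isOdd : ℕ → Bool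
isOdd n = not (isEven n)

-- T^n : alternating string of length n starting with 0
Tstr : (n : ℕ) → Str n
Tstr zero = []
Tstr (suc n) = Tstr n ∷ʳ (if isOdd (suc n) then 𝟘 else 𝟙)

CTstr : (n : ℕ) → Str n
CTstr n = map not (Tstr n)

_≟s_ : {n : ℕ} → (u v : Str n) → Bool
u ≟s v = does (≡-dec B._≟_ u v)

atLeast2 : ℕ → Bool
atLeast2 (suc (suc _)) = true
atLeast2 _ = false

sgn : ℤ → ℤ
sgn (+ zero) = + 0
sgn (+ suc _) = + 1
sgn -[1+ _ ] = - (+ 1)

-- l(w) = init w, r(w) = tail w
ξ : (n : ℕ) → Str n → ℤ
ξ zero [] = + 0
ξ (suc n) w =
  if atLeast2 (suc n) ∧ isEven (suc n) ∧ (w ≟s Tstr (suc n)) then + 1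
  else if atLeast2 (suc n) ∧ isEven (suc n) ∧ (w ≟s CTstr (suc n)) then - (+ 1)
  else sgn (ξ n (init w) + ξ n (tail w))

φ : (n : ℕ) → Str n → ℤ
φ zero [] = + 0
φ (suc n) w =
  if isOdd (suc n) ∧ (w ≟s replicate (suc n) 𝟘) then - (+ 1)
  else if isOdd (suc n) ∧ (w ≟s replicate (suc n) 𝟙) then + 1
  else sgn (φ n (tail w) Data.Integer.- φ n (init w))

-- ψ(w) = ξ(w)^{#w} φ(w), with 0^0 = 1 (as for Data.Integer._^_)
ψ : (n : ℕ) → Str n → ℤ
ψ n w = (ξ n w ^ n) Data.Integer.* φ n w

Colourable : {n : ℕ} → Str n → Set
Colourable {n} w = ¬ (ψ n w ≡ + 0)

allStr : (n : ℕ) → List (Str n)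
allStr zero = [] L.∷ L.[]
allStr (suc n) = concatMap (λ w → (𝟘 ∷ w) L.∷ (𝟙 ∷ w) L.∷ L.[]) (allStr n)

K : ℕ → ℕ
K n = length (filter (λ w → ψ n w ℤP.≟ + 0) (allStr n))

Sink : {n : ℕ} → Str n → Set
Sink w = ¬ Colourable (w ∷ʳ 𝟘) × ¬ Colourable (w ∷ʳ 𝟙)

colourable? : {n : ℕ} → (w : Str n) → Dec (Colourable w)
colourable? {n} w = ¬? (ψ n w ℤP.≟ + 0)

sink? : {n : ℕ} → (w : Str n) → Dec (Sink w)
sink? w = ¬? (colourable? (w ∷ʳ 𝟘)) ×-dec ¬? (colourable? (w ∷ʳ 𝟙))

S : ℕ → ℕ
S n = length (filter sink? (allStr n))

-- Both ξ(w) and φ(w) are determined by a finite summary of w: its first two and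
-- last two letters, the parity of #w, φ(w), and, unless w is 2-periodic, ξ(w). Once w is not
-- 2-periodic, ξ no longer changes when letters are added at both ends and φ only changes
-- sign, so the summary of a·w·b is a function of a, b and the summary of w. The recursions
-- defining ξ and φ then become identities between the summaries of l(w), r(w) and w; they
-- hold generically when all three summaries are settled, and every other such triple already
-- occurs for a string of length at most 5, where it is checked by computation.
--
-- As φ(w) = 0 forces ξ(w) = 0, w is non-colourable iff ξ(w) = 0, and w is a sink iff r(w) is
-- settled at ξ = 0. If Z(n) = atNilCount n counts the strings of length n+2 settled at 0, then
-- S(n+3) = 2 Z(n), while the 2-periodic strings contribute c = 2 or 4 (according to the parity
-- of n) to both K(n+2) = Z(n) + c and Z(n+2) = 4 Z(n) + c. Hence Z(n+1) = 2 Z(n) + (0 or 2),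
-- and K(n+3) = 2 Z(n) + 4 = S(n+3) + 4.

module Submission where

open import Defs
open import Data.Nat using (ℕ; _≤_)
open import Data.Integer using (+_; _-_)
open import Relation.Binary.PropositionalEquality using (_≡_)

open import Data.Bool as Bool using (Bool; true; false; not; _∧_; if_then_else_; T)
open import Data.Bool.ListAction using (all)
open import Data.Bool.Properties using (not-involutive; ∧-comm)
open import Data.Empty using (⊥; ⊥-elim)
open import Data.Integer as ℤ using (ℤ; -_)
import Data.Integer.Properties as ℤP
open import Data.List as List using (List; cartesianProduct; filter; length; concatMap)
open import Data.List.Membership.Propositional using (_∈_)
open import Data.List.Membership.Propositional.Properties
  using (∈-cartesianProduct⁺; ∈-concatMap⁺; ∈-map⁺; ∈-++⁺ˡ; ∈-++⁺ʳ)
import Data.List.Membership.DecPropositional as DecMembership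
import Data.List.Relation.Unary.All as All
open import Data.List.Relation.Unary.All.Properties using (all⁺)
import Data.List.Relation.Unary.Any as Any
open import Data.Maybe using (Maybe; just; nothing; fromMaybe; is-nothing)
open import Data.Maybe.Properties as MaybeP using (just-injective)
open import Data.Nat using (zero; suc; _+_; _*_; z≤n; s≤s)
open import Data.Nat.ListAction using (sum)
import Data.Nat.Properties as ℕP
open import Data.Nat.Tactic.RingSolver using (solve-∀)
open import Algebra.Properties.CommutativeSemigroup ℕP.+-commutativeSemigroup using (interchange)
open import Data.Product using (Σ; _×_; _,_; proj₁; proj₂)
open import Data.Product.Function.NonDependent.Propositional using (_×-⇔_)
open import Data.Product.Properties using (≡-dec)
open import Data.Sum using (_⊎_; inj₁; inj₂)
open import Data.Vec as Vec using ([]; _∷_; _∷ʳ_; head; tail; init; last; replicate; initLast)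
open import Data.Vec.Properties as VecP using (init-∷ʳ; last-∷ʳ; ∷-injectiveʳ)
open import Function using (_∘_; id; _⇔_; mk⇔)
import Function.Properties.Equivalence as ⇔
open import Relation.Binary.Definitions using (DecidableEquality)
open import Relation.Binary.PropositionalEquality
  using (_≢_; refl; sym; trans; cong; cong₂; subst; module ≡-Reasoning)
open import Relation.Nullary using (¬_; ¬?; yes; no; does)
open import Relation.Nullary.Decidable
  using (⌊_⌋; toWitness; map′; _×-dec_; _⊎-dec_; _→-dec_; does-⇔; decidable-stable)
import Relation.Unary as U

-- Lengths are written suc (suc n), never 2 + n: implicit vector lengths get solved in the
-- former shape, and a mismatch makes the type checker unfold ξ, φ and ψ symbolically.
private
  variable
    A B : Set
    n : ℕ

-- Signs

data Sgn : Set where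
  neg nil pos : Sgn

-ˢ_ : Sgn → Sgn
-ˢ neg = pos
-ˢ nil = nil
-ˢ pos = neg

infixl 6 _+ˢ_ _-ˢ_

_+ˢ_ : Sgn → Sgn → Sgn
nil +ˢ y   = y
x   +ˢ nil = x
neg +ˢ neg = neg
pos +ˢ pos = pos
neg +ˢ pos = nil
pos +ˢ neg = nil

_-ˢ_ : Sgn → Sgn → Sgn
x -ˢ y = x +ˢ (-ˢ y)

⟦_⟧ : Sgn → ℤ
⟦ neg ⟧ = - + 1
⟦ nil ⟧ = + 0
⟦ pos ⟧ = + 1

rise : Bool → Bool → Sgn
rise false true  = pos
rise true  false = neg
rise _     _     = nil

letterSign : Bool → Sgn
letterSign b = if b then pos else neg

infix 4 _≟ˢ_

_≟ˢ_ : DecidableEquality Sgn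
neg ≟ˢ neg = yes refl
nil ≟ˢ nil = yes refl
pos ≟ˢ pos = yes refl
neg ≟ˢ nil = no λ ()
neg ≟ˢ pos = no λ ()
nil ≟ˢ neg = no λ ()
nil ≟ˢ pos = no λ ()
pos ≟ˢ neg = no λ ()
pos ≟ˢ nil = no λ ()

-ˢ-nil : ∀ {x} → -ˢ x ≡ nil → x ≡ nil
-ˢ-nil {nil} _ = refl

infix 4 _≟ᵐ_

_≟ᵐ_ : DecidableEquality (Maybe Sgn)
_≟ᵐ_ = MaybeP.≡-dec _≟ˢ_

record Enumeration (A : Set) : Set where
  field
    elements : List A
    complete : ∀ x → x ∈ elements
open Enumeration

decide-all : {P : A → Set} (P? : U.Decidable P) {xs : List A} →
             T (all (λ x → ⌊ P? x ⌋) xs) → ∀ {x} → x ∈ xs → P x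
decide-all P? {xs} h x∈xs = toWitness (All.lookup (all⁺ _ xs h) x∈xs)

by-exhaustion : (E : Enumeration A) {P : A → Set} (P? : U.Decidable P) →
                T (all (λ x → ⌊ P? x ⌋) (elements E)) → ∀ x → P x
by-exhaustion E P? h x = decide-all P? h (complete E x)

bools : Enumeration Bool
bools = record
  { elements = false List.∷ true List.∷ List.[]
  ; complete = λ { false → Any.here refl ; true → Any.there (Any.here refl) }
  }

signs : Enumeration Sgn
signs = record
  { elements = neg List.∷ nil List.∷ pos List.∷ List.[]
  ; complete = λ { neg → Any.here refl ; nil → Any.there (Any.here refl)
                 ; pos → Any.there (Any.there (Any.here refl)) }
  }

infixr 2 _⊗_

_⊗_ : Enumeration A → Enumeration B → Enumeration (A × B)
E ⊗ F = record
  { elements = cartesianProduct (elements E) (elements F)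
  ; complete = λ (x , y) → ∈-cartesianProduct⁺ (complete E x) (complete F y)
  }

allStr-complete : (w : Str n) → w ∈ allStr n
allStr-complete []      = Any.here refl
allStr-complete (b ∷ w) = ∈-concatMap⁺ _ (Any.map (λ { refl → pick b }) (allStr-complete w))
  where
  pick : ∀ b → (b ∷ w) ∈ (false ∷ w) List.∷ (true ∷ w) List.∷ List.[]
  pick false = Any.here refl
  pick true  = Any.there (Any.here refl)

strings : ∀ n → Enumeration (Str n)
strings n = record { elements = allStr n ; complete = allStr-complete }

sgn-⟦+⟧ : ∀ x y → sgn (⟦ x ⟧ ℤ.+ ⟦ y ⟧) ≡ ⟦ x +ˢ y ⟧
sgn-⟦+⟧ x y = by-exhaustion (signs ⊗ signs)
  (λ (x , y) → sgn (⟦ x ⟧ ℤ.+ ⟦ y ⟧) ℤP.≟ ⟦ x +ˢ y ⟧) _ (x , y)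

sgn-⟦-⟧ : ∀ x y → sgn (⟦ x ⟧ ℤ.- ⟦ y ⟧) ≡ ⟦ x -ˢ y ⟧
sgn-⟦-⟧ x y = by-exhaustion (signs ⊗ signs)
  (λ (x , y) → sgn (⟦ x ⟧ ℤ.- ⟦ y ⟧) ℤP.≟ ⟦ x -ˢ y ⟧) _ (x , y)

-ˢ-distrib--ˢ : ∀ x y → -ˢ (x -ˢ y) ≡ (-ˢ x) -ˢ (-ˢ y)
-ˢ-distrib--ˢ x y = by-exhaustion (signs ⊗ signs)
  (λ (x , y) → (-ˢ (x -ˢ y)) ≟ˢ ((-ˢ x) -ˢ (-ˢ y))) _ (x , y)

^≡0⇒≡0 : ∀ i k → i ℤ.^ k ≡ + 0 → i ≡ + 0
^≡0⇒≡0 i (suc k) eq with ℤP.i*j≡0⇒i≡0∨j≡0 i eq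
... | inj₁ i≡0  = i≡0
... | inj₂ iᵏ≡0 = ^≡0⇒≡0 i k iᵏ≡0

⟦⟧≡0⇒nil : ∀ {x} → ⟦ x ⟧ ≡ + 0 → x ≡ nil
⟦⟧≡0⇒nil {nil} _ = refl

⟦⟧^*⟦⟧≡0⇔ : ∀ {x y} k → (y ≡ nil → x ≡ nil) →
             ⟦ x ⟧ ℤ.^ suc k ℤ.* ⟦ y ⟧ ≡ + 0 ⇔ x ≡ nil
⟦⟧^*⟦⟧≡0⇔ {x} {y} k y-nil⇒x-nil = mk⇔ to λ { refl → refl }
  where
  to : ⟦ x ⟧ ℤ.^ suc k ℤ.* ⟦ y ⟧ ≡ + 0 → x ≡ nil
  to eq with ℤP.i*j≡0⇒i≡0∨j≡0 (⟦ x ⟧ ℤ.^ suc k) eq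
  ... | inj₁ xᵏ≡0 = ⟦⟧≡0⇒nil (^≡0⇒≡0 _ (suc k) xᵏ≡0)
  ... | inj₂ y≡0  = y-nil⇒x-nil (⟦⟧≡0⇒nil y≡0)

-- Sums over all strings of a given length

χ : Bool → ℕ
χ true  = 1
χ false = 0

∑ : (n : ℕ) → (Str n → ℕ) → ℕ
∑ zero    f = f []
∑ (suc n) f = ∑ n (λ w → f (false ∷ w) + f (true ∷ w))

∑-cong : ∀ n {f g : Str n → ℕ} → (∀ w → f w ≡ g w) → ∑ n f ≡ ∑ n g
∑-cong zero    f≗g = f≗g []
∑-cong (suc n) f≗g = ∑-cong n (λ w → cong₂ _+_ (f≗g (false ∷ w)) (f≗g (true ∷ w)))

∑-+ : ∀ n (f g : Str n → ℕ) → ∑ n (λ w → f w + g w) ≡ ∑ n f + ∑ n g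
∑-+ zero    f g = refl
∑-+ (suc n) f g =
  trans (∑-cong n λ w → interchange (f (false ∷ w)) (g (false ∷ w)) (f (true ∷ w)) (g (true ∷ w)))
        (∑-+ n (λ w → f (false ∷ w) + f (true ∷ w)) (λ w → g (false ∷ w) + g (true ∷ w)))

∑-*ˡ : ∀ n c (f : Str n → ℕ) → ∑ n (λ w → c * f w) ≡ c * ∑ n f
∑-*ˡ zero    c f = refl
∑-*ˡ (suc n) c f =
  trans (∑-cong n (λ w → sym (ℕP.*-distribˡ-+ c (f (false ∷ w)) (f (true ∷ w)))))
        (∑-*ˡ n c (λ w → f (false ∷ w) + f (true ∷ w)))

∑-∷ : ∀ n (f : Str (suc n) → ℕ) →
      ∑ (suc n) f ≡ ∑ n (λ v → f (false ∷ v)) + ∑ n (λ v → f (true ∷ v))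
∑-∷ n f = ∑-+ n (λ v → f (false ∷ v)) (λ v → f (true ∷ v))

∑-∷ʳ : ∀ n (f : Str (suc n) → ℕ) →
       ∑ (suc n) f ≡ ∑ n (λ v → f (v ∷ʳ false) + f (v ∷ʳ true))
∑-∷ʳ zero    f = refl
∑-∷ʳ (suc n) f =
  trans (∑-∷ʳ n (λ w → f (false ∷ w) + f (true ∷ w)))
        (∑-cong n (λ v → interchange (f (false ∷ (v ∷ʳ false))) (f (true ∷ (v ∷ʳ false)))
                                     (f (false ∷ (v ∷ʳ true))) (f (true ∷ (v ∷ʳ true)))))

∑-single : (u : Str n) (f : Str n → ℕ) → (∀ v → v ≢ u → f v ≡ 0) → ∑ n f ≡ f u
∑-single []      f _   = refl
∑-single (b ∷ u) f off =
  trans (∑-single u _ λ v v≢u → cong₂ _+_ (off _ (v≢u ∘ ∷-injectiveʳ))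
                                          (off _ (v≢u ∘ ∷-injectiveʳ)))
        (other-vanishes b off)
  where
  other-vanishes : ∀ b → (∀ v → v ≢ b ∷ u → f v ≡ 0) →
                   f (false ∷ u) + f (true ∷ u) ≡ f (b ∷ u)
  other-vanishes false off =
    trans (cong (λ x → f (false ∷ u) + x) (off (true ∷ u) λ ())) (ℕP.+-identityʳ _)
  other-vanishes true  off = cong (_+ f (true ∷ u)) (off (false ∷ u) λ ())

∑-allStr : ∀ n (f : Str n → ℕ) → sum (List.map f (allStr n)) ≡ ∑ n f
∑-allStr zero    f = ℕP.+-identityʳ (f [])
∑-allStr (suc n) f = trans (sum-pairs (allStr n)) (∑-allStr n (λ w → f (false ∷ w) + f (true ∷ w)))
  where
  sum-pairs : ∀ ws →
    sum (List.map f (concatMap (λ w → (false ∷ w) List.∷ (true ∷ w) List.∷ List.[]) ws))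
    ≡ sum (List.map (λ w → f (false ∷ w) + f (true ∷ w)) ws)
  sum-pairs List.[]        = refl
  sum-pairs (w List.∷ ws) =
    trans (cong (λ x → f (false ∷ w) + (f (true ∷ w) + x)) (sum-pairs ws))
          (sym (ℕP.+-assoc (f (false ∷ w)) (f (true ∷ w)) _))

count-filter : ∀ n {P : Str n → Set} (P? : U.Decidable P) →
               length (filter P? (allStr n)) ≡ ∑ n (λ w → χ (does (P? w)))
count-filter n P? = trans (length-filter (allStr n)) (∑-allStr n _)
  where
  length-filter : ∀ ws → length (filter P? ws) ≡ sum (List.map (λ w → χ (does (P? w))) ws)
  length-filter List.[] = refl
  length-filter (w List.∷ ws) with does (P? w)
  ... | true  = cong suc (length-filter ws)
  ... | false = length-filter ws

-- Summaries of strings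

-- For a string w of length ≥ 2: settled is nothing exactly when w is 2-periodic, and
-- otherwise just ξ(w); then come the first two and the last two letters of w, whether
-- #w is even, and φ(w).
record Summary : Set where
  constructor mkSummary
  field
    settled     : Maybe Sgn
    first       : Bool
    second      : Bool
    penultimate : Bool
    final       : Bool
    evenLength  : Bool
    φ̂           : Sgn
open Summary

infix 4 _≟ₛ_

_≟ₛ_ : DecidableEquality Summary
s ≟ₛ t = map′ fields-injective (cong fields) (fields s ≟ᶠ fields t)
  where
  fields : Summary → Maybe Sgn × Bool × Bool × Bool × Bool × Bool × Sgn
  fields (mkSummary m a b c d e h) = m , a , b , c , d , e , h
  fields-injective : ∀ {s t} → fields s ≡ fields t → s ≡ t
  fields-injective {mkSummary _ _ _ _ _ _ _} {mkSummary _ _ _ _ _ _ _} refl = refl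
  _≟ᶠ_ = ≡-dec _≟ᵐ_ (≡-dec Bool._≟_ (≡-dec Bool._≟_ (≡-dec Bool._≟_
           (≡-dec Bool._≟_ (≡-dec Bool._≟_ _≟ˢ_)))))

ξ̂ : Summary → Sgn
ξ̂ s = fromMaybe (if evenLength s then rise (first s) (second s) else nil) (settled s)

settle : Maybe Sgn → Sgn → Sgn → Maybe Sgn
settle (just z) _   _   = just z
settle nothing  nil nil = nothing
settle nothing  x   y   = just (x +ˢ y)

φ-step : Summary → Bool → Bool → Sgn
φ-step s a b =
  if is-nothing (settled s) ∧ ⌊ first s Bool.≟ second s ⌋
  then (if evenLength s then rise a b
        else if ⌊ a Bool.≟ first s ⌋ ∧ ⌊ b Bool.≟ first s ⌋ then φ̂ s
        else -ˢ φ̂ s)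
  else -ˢ φ̂ s

-- The summary of a·w·b: it stays 2-periodic iff a and b repeat the letters two places
-- inward, and otherwise ξ(a·w·b) is the sign of the sum of the two mismatches.
extend : Bool → Bool → Summary → Summary
extend a b s = mkSummary
  (settle (settled s) (rise a (second s)) (rise (penultimate s) b))
  a (first s) (final s) b (evenLength s) (φ-step s a b)

φ₃ : Bool → Bool → Bool → Sgn
φ₃ a b c = if ⌊ a Bool.≟ b ⌋ ∧ ⌊ b Bool.≟ c ⌋ then letterSign a else -ˢ letterSign b

summary : Str (suc (suc n)) → Summary
summary {zero}        (a ∷ b ∷ [])     = mkSummary nothing a b a b true (rise a b)
summary {suc zero}    (a ∷ b ∷ c ∷ []) =
  mkSummary (settle nothing (rise a c) nil) a b b c false (φ₃ a b c)
summary {suc (suc n)} (a ∷ w)          = extend a (last w) (summary (init w))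

first-summary : (w : Str (suc (suc n))) → first (summary w) ≡ head w
first-summary {zero}        (a ∷ b ∷ [])     = refl
first-summary {suc zero}    (a ∷ b ∷ c ∷ []) = refl
first-summary {suc (suc n)} (a ∷ w)          = refl

final-summary : (w : Str (suc (suc n))) → final (summary w) ≡ last w
final-summary {zero}        (a ∷ b ∷ [])     = refl
final-summary {suc zero}    (a ∷ b ∷ c ∷ []) = refl
final-summary {suc (suc n)} (a ∷ w)          = refl

evenLength-summary : (w : Str (suc (suc n))) → evenLength (summary w) ≡ isEven n
evenLength-summary {zero}        (a ∷ b ∷ [])     = refl
evenLength-summary {suc zero}    (a ∷ b ∷ c ∷ []) = refl
evenLength-summary {suc (suc n)} (a ∷ w)          =
  trans (evenLength-summary (init w)) (sym (not-involutive (isEven n)))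

summary-∷-∷ʳ : ∀ a b (v : Str (suc (suc n))) → summary (a ∷ (v ∷ʳ b)) ≡ extend a b (summary v)
summary-∷-∷ʳ a b v = cong₂ (λ c u → extend a c (summary u)) (last-∷ʳ b v) (init-∷ʳ b v)

settled-view : ∀ s → settled s ≡ nothing ⊎ Σ Sgn (λ z → settled s ≡ just z)
settled-view record { settled = nothing } = inj₁ refl
settled-view record { settled = just z }  = inj₂ (z , refl)

settled-extend : ∀ a b s {z} → settled s ≡ just z → settled (extend a b s) ≡ just z
settled-extend a b record { settled = just z } refl = refl

ξ̂-settled : ∀ s {z} → settled s ≡ just z → ξ̂ s ≡ z
ξ̂-settled record { settled = just z } refl = refl

φ̂-extend : ∀ a b s {z} → settled s ≡ just z → φ̂ (extend a b s) ≡ -ˢ φ̂ s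
φ̂-extend a b record { settled = just z } refl = refl

rise-nil : ∀ a b → rise a b ≡ nil → a ≡ b
rise-nil false false _ = refl
rise-nil true  true  _ = refl

settle-nothing : ∀ m x y → settle m x y ≡ nothing → m ≡ nothing × x ≡ nil × y ≡ nil
settle-nothing nothing nil nil _ = refl , refl , refl

extend-unsettled : ∀ a b s → settled (extend a b s) ≡ nothing →
                   settled s ≡ nothing × a ≡ second s × penultimate s ≡ b
extend-unsettled a b s h with settle-nothing (settled s) _ _ h
... | m≡nothing , x≡nil , y≡nil = m≡nothing , rise-nil _ _ x≡nil , rise-nil _ _ y≡nil

periodic : Bool → Bool → (n : ℕ) → Str n
periodic a b zero    = []
periodic a b (suc n) = a ∷ periodic b a n

letterAt : Bool → Bool → ℕ → Bool
letterAt a b k = if isEven k then a else b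

letterAt-suc : ∀ a b k → letterAt a b (suc k) ≡ letterAt b a k
letterAt-suc a b k with isEven k
... | true  = refl
... | false = refl

periodic-∷ʳ : ∀ a b n → periodic a b n ∷ʳ letterAt a b n ≡ periodic a b (suc n)
periodic-∷ʳ a b zero    = refl
periodic-∷ʳ a b (suc n) =
  cong (a ∷_) (trans (cong (periodic b a n ∷ʳ_) (letterAt-suc a b n)) (periodic-∷ʳ b a n))

Tstr-periodic : ∀ n → Tstr n ≡ periodic false true n
Tstr-periodic zero    = refl
Tstr-periodic (suc n) =
  trans (cong₂ _∷ʳ_ (Tstr-periodic n) (lastLetter n)) (periodic-∷ʳ false true n)
  where
  lastLetter : ∀ n → (if isOdd (suc n) then 𝟘 else 𝟙) ≡ letterAt false true n
  lastLetter n with isEven n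
  ... | true  = refl
  ... | false = refl

complement-periodic : ∀ a b n → Vec.map not (periodic a b n) ≡ periodic (not a) (not b) n
complement-periodic a b zero    = refl
complement-periodic a b (suc n) = cong (not a ∷_) (complement-periodic b a n)

CTstr-periodic : ∀ n → CTstr n ≡ periodic true false n
CTstr-periodic n = trans (cong (Vec.map not) (Tstr-periodic n)) (complement-periodic false true n)

replicate-periodic : ∀ (c : Bool) n → replicate n c ≡ periodic c c n
replicate-periodic c zero    = refl
replicate-periodic c (suc n) = cong (c ∷_) (replicate-periodic c n)

periodicSummary : Bool → Bool → Bool → Summary
periodicSummary a b e =
  mkSummary nothing a b (if e then a else b) (if e then b else a) e
            (if e then rise a b else letterSign a)

summary-periodic : ∀ a b n → summary (periodic a b (suc (suc n))) ≡ periodicSummary a b (isEven n)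
summary-periodic a     b     zero          = refl
summary-periodic false false (suc zero)    = refl
summary-periodic false true  (suc zero)    = refl
summary-periodic true  false (suc zero)    = refl
summary-periodic true  true  (suc zero)    = refl
summary-periodic a     b     (suc (suc n)) = begin
  summary (a ∷ periodic b a (suc (suc (suc n))))
    ≡⟨ cong (summary ∘ (a ∷_)) (sym (periodic-∷ʳ b a (suc (suc n)))) ⟩
  summary (a ∷ (periodic b a (suc (suc n)) ∷ʳ letterAt b a (suc (suc n))))
    ≡⟨ summary-∷-∷ʳ a _ (periodic b a (suc (suc n))) ⟩
  extend a (letterAt b a (suc (suc n))) (summary (periodic b a (suc (suc n))))
    ≡⟨ cong₂ (extend a) (cong (λ e → if e then b else a) (not-involutive (isEven n)))
                        (summary-periodic b a n) ⟩
  extend a (if isEven n then b else a) (periodicSummary b a (isEven n))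
    ≡⟨ extend-periodicSummary a b (isEven n) ⟩
  periodicSummary a b (isEven n)
    ≡⟨ cong (periodicSummary a b) (sym (not-involutive (isEven n))) ⟩
  periodicSummary a b (isEven (suc (suc n))) ∎
  where
  open ≡-Reasoning
  extend-periodicSummary : ∀ a b e →
    extend a (if e then b else a) (periodicSummary b a e) ≡ periodicSummary a b e
  extend-periodicSummary a b e = by-exhaustion (bools ⊗ bools ⊗ bools)
    (λ (a , b , e) → extend a (if e then b else a) (periodicSummary b a e) ≟ₛ periodicSummary a b e)
    _ (a , b , e)

unsettled⇒periodic : ∀ a b (v : Str n) →
                     settled (summary (a ∷ b ∷ v)) ≡ nothing → v ≡ periodic a b n
unsettled⇒periodic a     b []                 _ = refl
unsettled⇒periodic false b (false ∷ [])       _ = refl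
unsettled⇒periodic true  b (true ∷ [])        _ = refl
unsettled⇒periodic {suc (suc m)} a b (c ∷ d ∷ r) h
  with extend-unsettled a (last (d ∷ r)) (summary (b ∷ c ∷ init (d ∷ r))) h
... | inner-unsettled , a≡second , penultimate≡last
  with unsettled⇒periodic b c (init (d ∷ r)) inner-unsettled
... | init≡periodic = cong₂ _∷_ c≡a tail≡periodic
  where
  open ≡-Reasoning
  inner≡ : summary (b ∷ c ∷ init (d ∷ r)) ≡ periodicSummary b c (isEven m)
  inner≡ = trans (cong (λ u → summary (b ∷ c ∷ u)) init≡periodic) (summary-periodic b c _)
  c≡a : c ≡ a
  c≡a = sym (trans a≡second (cong second inner≡))
  tail≡periodic : d ∷ r ≡ periodic b a (suc m)
  tail≡periodic = begin
    d ∷ r                             ≡⟨ proj₂ (proj₂ (initLast (d ∷ r))) ⟩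
    init (d ∷ r) ∷ʳ last (d ∷ r)      ≡⟨ cong₂ _∷ʳ_ init≡periodic
                                           (trans (sym penultimate≡last) (cong penultimate inner≡)) ⟩
    periodic b c m ∷ʳ letterAt b c m  ≡⟨ periodic-∷ʳ b c m ⟩
    periodic b c (suc m)              ≡⟨ cong (λ x → periodic b x (suc m)) c≡a ⟩
    periodic b a (suc m)              ∎

unsettled-summary : ∀ a b (v : Str n) → settled (summary (a ∷ b ∷ v)) ≡ nothing →
                    summary (a ∷ b ∷ v) ≡ periodicSummary a b (isEven n)
unsettled-summary a b v h =
  trans (cong (λ u → summary (a ∷ b ∷ u)) (unsettled⇒periodic a b v h)) (summary-periodic a b _)

PeriodicWith : Bool → Bool → Summary → Set
PeriodicWith a b s = settled s ≡ nothing × first s ≡ a × second s ≡ b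

periodicWith? : ∀ a b → U.Decidable (PeriodicWith a b)
periodicWith? a b s =
  (settled s ≟ᵐ nothing) ×-dec (first s Bool.≟ a) ×-dec (second s Bool.≟ b)

periodicWith : Bool → Bool → Summary → Bool
periodicWith a b s = does (periodicWith? a b s)

second-summary : ∀ a b (v : Str n) → second (summary (a ∷ b ∷ v)) ≡ b
second-summary {zero}        a b []          = refl
second-summary {suc zero}    a b (c ∷ [])    = refl
second-summary {suc (suc n)} a b (c ∷ d ∷ v) = first-summary (b ∷ c ∷ init (d ∷ v))

periodic⇔PeriodicWith : ∀ a b (w : Str (suc (suc n))) →
                        w ≡ periodic a b (suc (suc n)) ⇔ PeriodicWith a b (summary w)
periodic⇔PeriodicWith {n} a b (c ∷ d ∷ v) = mk⇔ to from
  where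
  to : c ∷ d ∷ v ≡ periodic a b (suc (suc n)) → PeriodicWith a b (summary (c ∷ d ∷ v))
  to refl = subst (PeriodicWith a b) (sym (summary-periodic a b n)) (refl , refl , refl)
  from : PeriodicWith a b (summary (c ∷ d ∷ v)) → c ∷ d ∷ v ≡ periodic a b (suc (suc n))
  from (unsettled , first≡a , second≡b) =
    trans (cong (λ u → c ∷ d ∷ u) (unsettled⇒periodic c d v unsettled))
          (cong₂ (λ x y → periodic x y (suc (suc n)))
                 (trans (sym (first-summary (c ∷ d ∷ v))) first≡a)
                 (trans (sym (second-summary c d v)) second≡b))

-- The recursions for ξ and φ on summaries

Triple : Set
Triple = Summary × Summary × Summary

infix 4 _≟ₜ_

_≟ₜ_ : DecidableEquality Triple
_≟ₜ_ = ≡-dec _≟ₛ_ (≡-dec _≟ₛ_ _≟ₛ_)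

triple : Str (suc (suc (suc n))) → Triple
triple w = summary (init w) , summary (tail w) , summary w

extend₃ : Bool → Bool → Triple → Triple
extend₃ a b (sl , sr , s) = extend a (final s) sl , extend (first s) b sr , extend a b s

triple-extend₃ : ∀ a (w : Str (suc (suc (suc (suc n))))) →
                 triple (a ∷ w) ≡ extend₃ a (last w) (triple (init w))
triple-extend₃ a (c ∷ w) =
  cong₂ (λ x y → extend a x (summary (init (init (c ∷ w))))
               , extend y (last w) (summary (init w))
               , extend a (last w) (summary (init (c ∷ w))))
        (sym (final-summary (init (c ∷ w)))) (sym (first-summary (init (c ∷ w))))


ξ-rule : Triple → Sgn
ξ-rule (sl , sr , s) =
  if periodicWith false true s ∧ evenLength s then pos
  else if periodicWith true false s ∧ evenLength s then neg
  else ξ̂ sl +ˢ ξ̂ sr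

φ-rule : Triple → Sgn
φ-rule (sl , sr , s) =
  if periodicWith false false s ∧ not (evenLength s) then neg
  else if periodicWith true true s ∧ not (evenLength s) then pos
  else φ̂ sr -ˢ φ̂ sl

Sound : Triple → Set
Sound t@(_ , _ , s) = ξ̂ s ≡ ξ-rule t × φ̂ s ≡ φ-rule t

sound? : U.Decidable Sound
sound? t@(_ , _ , s) = (ξ̂ s ≟ˢ ξ-rule t) ×-dec (φ̂ s ≟ˢ φ-rule t)

Coherent : Triple → Set
Coherent ( record { settled = just x ; φ̂ = p }
         , record { settled = just y ; φ̂ = q }
         , record { settled = just z ; φ̂ = r }) = z ≡ x +ˢ y × r ≡ q -ˢ p
Coherent _ = ⊥

coherent? : U.Decidable Coherent
coherent? ( record { settled = just x ; φ̂ = p }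
          , record { settled = just y ; φ̂ = q }
          , record { settled = just z ; φ̂ = r }) = (z ≟ˢ x +ˢ y) ×-dec (r ≟ˢ q -ˢ p)
coherent? (record { settled = nothing } , _ , _) = no λ ()
coherent? (record { settled = just _ } , record { settled = nothing } , _) = no λ ()
coherent? (record { settled = just _ } , record { settled = just _ } , record { settled = nothing }) =
  no λ ()

coherent-sound : ∀ t → Coherent t → Sound t
coherent-sound (record { settled = just _ } , record { settled = just _ } , record { settled = just _ }) c =
  c

coherent-extend₃ : ∀ a b t → Coherent t → Coherent (extend₃ a b t)
coherent-extend₃ a b ( record { settled = just _ ; φ̂ = p } , record { settled = just _ ; φ̂ = q }
                     , record { settled = just _ }) (z≡x+y , refl) = z≡x+y , -ˢ-distrib--ˢ q p

-- Every non-coherent triple of a string already occurs for a string of length 3, 4 or 5 (the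
-- strings of length 5 are included so that extending a listed triple stays inside the list).
smallTriples : List Triple
smallTriples = List.map triple (allStr 3) List.++ List.map triple (allStr 4)
               List.++ List.map triple (allStr 5)

Invariant : Triple → Set
Invariant t = Coherent t ⊎ t ∈ smallTriples

invariant? : U.Decidable Invariant
invariant? t = coherent? t ⊎-dec (t ∈? smallTriples)
  where open DecMembership _≟ₜ_ using (_∈?_)

small-sound : ∀ {t} → t ∈ smallTriples → Sound t
small-sound = decide-all sound? _

small-extend₃ : ∀ {t} → t ∈ smallTriples → ∀ a b → Invariant (extend₃ a b t)
small-extend₃ t∈ a b = decide-all (λ (t , a , b) → invariant? (extend₃ a b t))
  {cartesianProduct smallTriples (elements (bools ⊗ bools))} _
  (∈-cartesianProduct⁺ t∈ (complete (bools ⊗ bools) (a , b)))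

invariant-extend₃ : ∀ a b t → Invariant t → Invariant (extend₃ a b t)
invariant-extend₃ a b t (inj₁ c)  = inj₁ (coherent-extend₃ a b t c)
invariant-extend₃ a b t (inj₂ t∈) = small-extend₃ t∈ a b

invariant-sound : ∀ t → Invariant t → Sound t
invariant-sound t (inj₁ c)  = coherent-sound t c
invariant-sound t (inj₂ t∈) = small-sound t∈

triple-invariant : (w : Str (suc (suc (suc n)))) → Invariant (triple w)
triple-invariant {zero}        w = inj₂ (∈-++⁺ˡ (∈-map⁺ triple (allStr-complete w)))
triple-invariant {suc zero}    w =
  inj₂ (∈-++⁺ʳ (List.map triple (allStr 3)) (∈-++⁺ˡ (∈-map⁺ triple (allStr-complete w))))
triple-invariant {suc (suc n)} (a ∷ w) =
  subst Invariant (sym (triple-extend₃ a w))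
        (invariant-extend₃ a (last w) _ (triple-invariant (init w)))

≟s-periodic : ∀ (p : Bool → Bool) a b (w : Str (suc (suc n))) →
  p (isEven (suc (suc n))) ∧ (w ≟s periodic a b _)
  ≡ periodicWith a b (summary w) ∧ p (evenLength (summary w))
≟s-periodic {n} p a b w = begin
  p (isEven (suc (suc n))) ∧ (w ≟s periodic a b _)
    ≡⟨ cong₂ (λ e t → p e ∧ t) (trans (not-involutive (isEven n)) (sym (evenLength-summary w)))
                               (does-⇔ (periodic⇔PeriodicWith a b w) (VecP.≡-dec Bool._≟_ w _)
                                       (periodicWith? a b (summary w))) ⟩
  p (evenLength (summary w)) ∧ periodicWith a b (summary w)
    ≡⟨ ∧-comm (p (evenLength (summary w))) _ ⟩
  periodicWith a b (summary w) ∧ p (evenLength (summary w)) ∎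
  where open ≡-Reasoning

ξ-unfold : (w : Str (suc (suc (suc n)))) → let s = summary w in
  ξ _ w ≡ (if periodicWith false true s ∧ evenLength s then + 1
           else if periodicWith true false s ∧ evenLength s then - (+ 1)
           else sgn (ξ _ (init w) ℤ.+ ξ _ (tail w)))
ξ-unfold {n} w =
  cong₂ (λ c d → if c then + 1 else if d then - (+ 1) else sgn (ξ _ (init w) ℤ.+ ξ _ (tail w)))
        (trans (cong (λ u → isEven m ∧ (w ≟s u)) (Tstr-periodic m)) (≟s-periodic id false true w))
        (trans (cong (λ u → isEven m ∧ (w ≟s u)) (CTstr-periodic m)) (≟s-periodic id true false w))
  where m = suc (suc (suc n))

φ-unfold : (w : Str (suc (suc (suc n)))) → let s = summary w in
  φ _ w ≡ (if periodicWith false false s ∧ not (evenLength s) then - (+ 1)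
           else if periodicWith true true s ∧ not (evenLength s) then + 1
           else sgn (φ _ (tail w) ℤ.- φ _ (init w)))
φ-unfold {n} w =
  cong₂ (λ c d → if c then - (+ 1) else if d then + 1 else sgn (φ _ (tail w) ℤ.- φ _ (init w)))
        (trans (cong (λ u → isOdd m ∧ (w ≟s u)) (replicate-periodic false m))
               (≟s-periodic not false false w))
        (trans (cong (λ u → isOdd m ∧ (w ≟s u)) (replicate-periodic true m))
               (≟s-periodic not true true w))
  where m = suc (suc (suc n))

⟦⟧-if : ∀ c d x y z → ⟦ if c then x else if d then y else z ⟧
                    ≡ (if c then ⟦ x ⟧ else if d then ⟦ y ⟧ else ⟦ z ⟧)
⟦⟧-if true  _     _ _ _ = refl
⟦⟧-if false true  _ _ _ = refl
⟦⟧-if false false _ _ _ = refl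

ξ-summary : (w : Str (suc (suc n))) → ξ _ w ≡ ⟦ ξ̂ (summary w) ⟧
ξ-summary {zero}  = by-exhaustion (strings 2) (λ w → ξ 2 w ℤP.≟ ⟦ ξ̂ (summary w) ⟧) _
ξ-summary {suc n} w = begin
  ξ _ w                                         ≡⟨ ξ-unfold w ⟩
  pinned (sgn (ξ _ (init w) ℤ.+ ξ _ (tail w)))  ≡⟨ cong₂ (λ x y → pinned (sgn (x ℤ.+ y)))
                                                         (ξ-summary (init w)) (ξ-summary (tail w)) ⟩
  pinned (sgn (⟦ ξ̂ sl ⟧ ℤ.+ ⟦ ξ̂ sr ⟧))          ≡⟨ cong pinned (sgn-⟦+⟧ (ξ̂ sl) (ξ̂ sr)) ⟩
  pinned ⟦ ξ̂ sl +ˢ ξ̂ sr ⟧                       ≡⟨ sym (⟦⟧-if ξ⁺ ξ⁻ pos neg _) ⟩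
  ⟦ ξ-rule (triple w) ⟧                         ≡⟨ cong ⟦_⟧ (sym (proj₁ sound)) ⟩
  ⟦ ξ̂ (summary w) ⟧                             ∎
  where
  open ≡-Reasoning
  sl sr s : Summary
  sl = summary (init w)
  sr = summary (tail w)
  s  = summary w
  ξ⁺ ξ⁻ : Bool
  ξ⁺ = periodicWith false true s ∧ evenLength s
  ξ⁻ = periodicWith true false s ∧ evenLength s
  sound : Sound (triple w)
  sound = invariant-sound _ (triple-invariant w)
  pinned : ℤ → ℤ
  pinned z = if ξ⁺ then + 1 else if ξ⁻ then - (+ 1) else z

φ-summary : (w : Str (suc (suc n))) → φ _ w ≡ ⟦ φ̂ (summary w) ⟧
φ-summary {zero}  = by-exhaustion (strings 2) (λ w → φ 2 w ℤP.≟ ⟦ φ̂ (summary w) ⟧) _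
φ-summary {suc n} w = begin
  φ _ w                                         ≡⟨ φ-unfold w ⟩
  pinned (sgn (φ _ (tail w) ℤ.- φ _ (init w)))  ≡⟨ cong₂ (λ x y → pinned (sgn (x ℤ.- y)))
                                                         (φ-summary (tail w)) (φ-summary (init w)) ⟩
  pinned (sgn (⟦ φ̂ sr ⟧ ℤ.- ⟦ φ̂ sl ⟧))          ≡⟨ cong pinned (sgn-⟦-⟧ (φ̂ sr) (φ̂ sl)) ⟩
  pinned ⟦ φ̂ sr -ˢ φ̂ sl ⟧                       ≡⟨ sym (⟦⟧-if φ⁻ φ⁺ neg pos _) ⟩
  ⟦ φ-rule (triple w) ⟧                         ≡⟨ cong ⟦_⟧ (sym (proj₂ sound)) ⟩
  ⟦ φ̂ (summary w) ⟧                             ∎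
  where
  open ≡-Reasoning
  sl sr s : Summary
  sl = summary (init w)
  sr = summary (tail w)
  s  = summary w
  φ⁻ φ⁺ : Bool
  φ⁻ = periodicWith false false s ∧ not (evenLength s)
  φ⁺ = periodicWith true true s ∧ not (evenLength s)
  sound : Sound (triple w)
  sound = invariant-sound _ (triple-invariant w)
  pinned : ℤ → ℤ
  pinned z = if φ⁻ then - (+ 1) else if φ⁺ then + 1 else z

-- Colourability and sinks

φ̂-nil⇒ξ̂-nil : (w : Str (suc (suc n))) → φ̂ (summary w) ≡ nil → ξ̂ (summary w) ≡ nil
φ̂-nil⇒ξ̂-nil {zero}     = by-exhaustion (strings 2)
  (λ w → (φ̂ (summary w) ≟ˢ nil) →-dec (ξ̂ (summary w) ≟ˢ nil)) _
φ̂-nil⇒ξ̂-nil {suc zero} = by-exhaustion (strings 3)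
  (λ w → (φ̂ (summary w) ≟ˢ nil) →-dec (ξ̂ (summary w) ≟ˢ nil)) _
φ̂-nil⇒ξ̂-nil {suc (suc n)} (a ∷ w) =
  extend-preserves a (last w) (init w) (φ̂-nil⇒ξ̂-nil (init w))
  where
  extend-periodic : ∀ a b p q e → φ̂ (extend a b (periodicSummary p q e)) ≡ nil →
                                  ξ̂ (extend a b (periodicSummary p q e)) ≡ nil
  extend-periodic a b p q e = by-exhaustion (bools ⊗ bools ⊗ bools ⊗ bools ⊗ bools)
    (λ (a , b , p , q , e) → (φ̂ (extend a b (periodicSummary p q e)) ≟ˢ nil)
                             →-dec (ξ̂ (extend a b (periodicSummary p q e)) ≟ˢ nil))
    _ (a , b , p , q , e)
  extend-preserves : ∀ a b (v : Str (suc (suc n))) →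
                     (φ̂ (summary v) ≡ nil → ξ̂ (summary v) ≡ nil) →
                     φ̂ (extend a b (summary v)) ≡ nil → ξ̂ (extend a b (summary v)) ≡ nil
  extend-preserves a b (c ∷ d ∷ r) ih with settled-view (summary (c ∷ d ∷ r))
  ... | inj₁ unsettled rewrite unsettled-summary c d r unsettled = extend-periodic a b c d _
  ... | inj₂ (z , eq) = λ h →
    trans (ξ̂-settled (extend a b s) (settled-extend a b s eq))
          (trans (sym (ξ̂-settled s eq)) (ih (-ˢ-nil (trans (sym (φ̂-extend a b s eq)) h))))
    where s = summary (c ∷ d ∷ r)

ψ≡0⇔ξ̂≡nil : (w : Str (suc (suc n))) → ψ (suc (suc n)) w ≡ + 0 ⇔ ξ̂ (summary w) ≡ nil
ψ≡0⇔ξ̂≡nil {n} w =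
  subst (λ i → i ≡ + 0 ⇔ ξ̂ (summary w) ≡ nil)
        (sym (cong₂ (λ x y → x ℤ.^ (suc (suc n)) ℤ.* y) (ξ-summary w) (φ-summary w)))
        (⟦⟧^*⟦⟧≡0⇔ (suc n) (φ̂-nil⇒ξ̂-nil w))

nonColourable⇔ξ̂≡nil : (w : Str (suc (suc n))) → (¬ Colourable w) ⇔ ξ̂ (summary w) ≡ nil
nonColourable⇔ξ̂≡nil {n} w =
  ⇔.trans (mk⇔ (decidable-stable (ψ (suc (suc n)) w ℤP.≟ + 0)) (λ ψ≡0 ψ≢0 → ψ≢0 ψ≡0))
          (ψ≡0⇔ξ̂≡nil w)

extensions-nil⇔settled-nil : ∀ c (v : Str (suc (suc n))) →
  (ξ̂ (extend c false (summary v)) ≡ nil × ξ̂ (extend c true (summary v)) ≡ nil)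
  ⇔ settled (summary v) ≡ just nil
extensions-nil⇔settled-nil c (a ∷ b ∷ r) with settled-view (summary (a ∷ b ∷ r))
... | inj₁ unsettled rewrite unsettled-summary a b r unsettled =
  mk⇔ (⊥-elim ∘ periodic-not-both c a b _) λ ()
  where
  periodic-not-both : ∀ c p q e → ¬ (ξ̂ (extend c false (periodicSummary p q e)) ≡ nil ×
                                     ξ̂ (extend c true (periodicSummary p q e)) ≡ nil)
  periodic-not-both c p q e = by-exhaustion (bools ⊗ bools ⊗ bools ⊗ bools)
    (λ (c , p , q , e) → ¬? ((ξ̂ (extend c false (periodicSummary p q e)) ≟ˢ nil) ×-dec
                             (ξ̂ (extend c true (periodicSummary p q e)) ≟ˢ nil)))
    _ (c , p , q , e)
... | inj₂ (z , eq) =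
  mk⇔ (λ (z≡nil , _) → trans eq (cong just (trans (sym (ξ̂-extension false)) z≡nil)))
      (λ eq′ → let z≡nil = just-injective (trans (sym eq) eq′) in
               trans (ξ̂-extension false) z≡nil , trans (ξ̂-extension true) z≡nil)
  where
  s = summary (a ∷ b ∷ r)
  ξ̂-extension : ∀ d → ξ̂ (extend c d s) ≡ z
  ξ̂-extension d = ξ̂-settled (extend c d s) (settled-extend c d s eq)

sink⇔settled-nil : ∀ c (v : Str (suc (suc n))) → Sink (c ∷ v) ⇔ settled (summary v) ≡ just nil
sink⇔settled-nil c v =
  ⇔.trans (extension-nonColourable false ×-⇔ extension-nonColourable true)
          (extensions-nil⇔settled-nil c v)
  where
  extension-nonColourable : ∀ d → (¬ Colourable (c ∷ (v ∷ʳ d))) ⇔ ξ̂ (extend c d (summary v)) ≡ nil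
  extension-nonColourable d =
    subst (λ s → (¬ Colourable (c ∷ (v ∷ʳ d))) ⇔ ξ̂ s ≡ nil) (summary-∷-∷ʳ c d v)
          (nonColourable⇔ξ̂≡nil (c ∷ (v ∷ʳ d)))

-- Counting

settledAtNil : Summary → Bool
settledAtNil s = does (settled s ≟ᵐ just nil)

ξ̂-nil : Summary → Bool
ξ̂-nil s = does (ξ̂ s ≟ˢ nil)

onUnsettled : (Summary → ℕ) → Summary → ℕ
onUnsettled g s = if is-nothing (settled s) then g s else 0

onUnsettled-settled : ∀ g s {z} → settled s ≡ just z → onUnsettled g s ≡ 0
onUnsettled-settled g record { settled = just _ } refl = refl

periodicSum : (Summary → ℕ) → Bool → ℕ
periodicSum g e = (g (periodicSummary false false e) + g (periodicSummary false true e))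
                + (g (periodicSummary true false e) + g (periodicSummary true true e))

∑-onUnsettled : ∀ n (g : Summary → ℕ) →
                ∑ (suc (suc n)) (λ w → onUnsettled g (summary w)) ≡ periodicSum g (isEven n)
∑-onUnsettled n g =
  trans (∑-∷ (suc n) h)
        (cong₂ _+_ (trans (∑-∷ n (λ v → h (false ∷ v)))
                          (cong₂ _+_ (periodic-term false false) (periodic-term false true)))
                   (trans (∑-∷ n (λ v → h (true ∷ v)))
                          (cong₂ _+_ (periodic-term true false) (periodic-term true true))))
  where
  h : Str (suc (suc n)) → ℕ
  h w = onUnsettled g (summary w)
  periodic-term : ∀ a b → ∑ n (λ v → h (a ∷ b ∷ v)) ≡ g (periodicSummary a b (isEven n))
  periodic-term a b =
    trans (∑-single (periodic a b n) _ off) (cong (onUnsettled g) (summary-periodic a b n))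
    where
    off : ∀ v → v ≢ periodic a b n → h (a ∷ b ∷ v) ≡ 0
    off v v≢periodic with settled-view (summary (a ∷ b ∷ v))
    ... | inj₁ unsettled = ⊥-elim (v≢periodic (unsettled⇒periodic a b v unsettled))
    ... | inj₂ (_ , eq)  = onUnsettled-settled g _ eq

ξ̂-nil-split : ∀ s → χ (ξ̂-nil s) ≡ χ (settledAtNil s) + onUnsettled (χ ∘ ξ̂-nil) s
ξ̂-nil-split record { settled = nothing }  = refl
ξ̂-nil-split record { settled = just neg } = refl
ξ̂-nil-split record { settled = just nil } = refl
ξ̂-nil-split record { settled = just pos } = refl

extensionsAtNil : Summary → ℕ
extensionsAtNil s = (atNil false false + atNil true false) + (atNil false true + atNil true true)
  where
  atNil : Bool → Bool → ℕ
  atNil a b = χ (settledAtNil (extend a b s))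

extensionsAtNil-split : ∀ s →
  extensionsAtNil s ≡ 4 * χ (settledAtNil s) + onUnsettled extensionsAtNil s
extensionsAtNil-split record { settled = nothing }  = refl
extensionsAtNil-split record { settled = just neg } = refl
extensionsAtNil-split record { settled = just nil } = refl
extensionsAtNil-split record { settled = just pos } = refl

periodicCount : Bool → ℕ
periodicCount e = if e then 2 else 4

periodicSum-ξ̂-nil : ∀ e → periodicSum (χ ∘ ξ̂-nil) e ≡ periodicCount e
periodicSum-ξ̂-nil true  = refl
periodicSum-ξ̂-nil false = refl

periodicSum-extensionsAtNil : ∀ e → periodicSum extensionsAtNil e ≡ periodicCount e
periodicSum-extensionsAtNil true  = refl
periodicSum-extensionsAtNil false = refl

atNil : Str (suc (suc n)) → ℕ
atNil w = χ (settledAtNil (summary w))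

atNilCount : ℕ → ℕ
atNilCount n = ∑ (suc (suc n)) atNil

K-count : ∀ n → K (suc (suc n)) ≡ atNilCount n + periodicCount (isEven n)
K-count n = begin
  K (suc (suc n))
    ≡⟨ count-filter (suc (suc n)) (λ w → ψ (suc (suc n)) w ℤP.≟ + 0) ⟩
  ∑ (suc (suc n)) (λ w → χ (does (ψ (suc (suc n)) w ℤP.≟ + 0)))
    ≡⟨ ∑-cong (suc (suc n)) nonColourable-split ⟩
  ∑ (suc (suc n)) (λ w → atNil w + onUnsettled (χ ∘ ξ̂-nil) (summary w))
    ≡⟨ ∑-+ (suc (suc n)) atNil (λ w → onUnsettled (χ ∘ ξ̂-nil) (summary w)) ⟩
  atNilCount n + ∑ (suc (suc n)) (λ w → onUnsettled (χ ∘ ξ̂-nil) (summary w))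
    ≡⟨ cong (λ x → atNilCount n + x) (∑-onUnsettled n (χ ∘ ξ̂-nil)) ⟩
  atNilCount n + periodicSum (χ ∘ ξ̂-nil) (isEven n)
    ≡⟨ cong (λ x → atNilCount n + x) (periodicSum-ξ̂-nil (isEven n)) ⟩
  atNilCount n + periodicCount (isEven n) ∎
  where
  open ≡-Reasoning
  nonColourable-split : ∀ w → χ (does (ψ (suc (suc n)) w ℤP.≟ + 0))
                              ≡ atNil w + onUnsettled (χ ∘ ξ̂-nil) (summary w)
  nonColourable-split w =
    trans (cong χ (does-⇔ (ψ≡0⇔ξ̂≡nil w) (ψ (suc (suc n)) w ℤP.≟ + 0) (ξ̂ (summary w) ≟ˢ nil)))
          (ξ̂-nil-split (summary w))

S-count : ∀ n → S (suc (suc (suc n))) ≡ atNilCount n + atNilCount n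
S-count n = begin
  S (suc (suc (suc n)))
    ≡⟨ count-filter (suc (suc (suc n))) sink? ⟩
  ∑ (suc (suc (suc n))) (λ w → χ (does (sink? w)))
    ≡⟨ ∑-∷ (suc (suc n)) (λ w → χ (does (sink? w))) ⟩
  ∑ (suc (suc n)) (λ v → χ (does (sink? (false ∷ v))))
  + ∑ (suc (suc n)) (λ v → χ (does (sink? (true ∷ v))))
    ≡⟨ cong₂ _+_ (∑-cong (suc (suc n)) (sink-atNil false)) (∑-cong (suc (suc n)) (sink-atNil true)) ⟩
  atNilCount n + atNilCount n ∎
  where
  open ≡-Reasoning
  sink-atNil : ∀ c (v : Str (suc (suc n))) → χ (does (sink? (c ∷ v))) ≡ atNil v
  sink-atNil c v =
    cong χ (does-⇔ (sink⇔settled-nil c v) (sink? (c ∷ v)) (settled (summary v) ≟ᵐ just nil))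

atNilCount-step : ∀ n → atNilCount (suc (suc n)) ≡ 4 * atNilCount n + periodicCount (isEven n)
atNilCount-step n = begin
  ∑ (suc (suc (suc n))) (λ u → atNil (false ∷ u) + atNil (true ∷ u))
    ≡⟨ ∑-∷ʳ (suc (suc n)) (λ u → atNil (false ∷ u) + atNil (true ∷ u)) ⟩
  ∑ (suc (suc n)) (λ v → (atNil (false ∷ (v ∷ʳ false)) + atNil (true ∷ (v ∷ʳ false)))
                       + (atNil (false ∷ (v ∷ʳ true)) + atNil (true ∷ (v ∷ʳ true))))
    ≡⟨ ∑-cong (suc (suc n)) extensions-split ⟩
  ∑ (suc (suc n)) (λ v → 4 * atNil v + onUnsettled extensionsAtNil (summary v))
    ≡⟨ ∑-+ (suc (suc n)) (λ v → 4 * atNil v) (λ v → onUnsettled extensionsAtNil (summary v)) ⟩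
  ∑ (suc (suc n)) (λ v → 4 * atNil v)
  + ∑ (suc (suc n)) (λ v → onUnsettled extensionsAtNil (summary v))
    ≡⟨ cong₂ _+_ (∑-*ˡ (suc (suc n)) 4 atNil) (∑-onUnsettled n extensionsAtNil) ⟩
  4 * atNilCount n + periodicSum extensionsAtNil (isEven n)
    ≡⟨ cong (λ x → 4 * atNilCount n + x) (periodicSum-extensionsAtNil (isEven n)) ⟩
  4 * atNilCount n + periodicCount (isEven n) ∎
  where
  open ≡-Reasoning
  peel : ∀ a b (v : Str (suc (suc n))) →
         atNil (a ∷ (v ∷ʳ b)) ≡ χ (settledAtNil (extend a b (summary v)))
  peel a b v = cong (χ ∘ settledAtNil) (summary-∷-∷ʳ a b v)
  extensions-split : ∀ v → (atNil (false ∷ (v ∷ʳ false)) + atNil (true ∷ (v ∷ʳ false)))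
                           + (atNil (false ∷ (v ∷ʳ true)) + atNil (true ∷ (v ∷ʳ true)))
                         ≡ 4 * atNil v + onUnsettled extensionsAtNil (summary v)
  extensions-split v =
    trans (cong₂ _+_ (cong₂ _+_ (peel false false v) (peel true false v))
                     (cong₂ _+_ (peel false true v) (peel true true v)))
          (extensionsAtNil-split (summary v))

oddExtra : Bool → ℕ
oddExtra e = if e then 0 else 2

atNilCount-suc : ∀ n → atNilCount (suc n) ≡ 2 * atNilCount n + oddExtra (isEven n)
atNilCount-suc zero    = refl
atNilCount-suc (suc n) = begin
  atNilCount (suc (suc n))
    ≡⟨ atNilCount-step n ⟩
  4 * atNilCount n + periodicCount (isEven n)
    ≡⟨ doubling (isEven n) (atNilCount n) ⟩
  2 * (2 * atNilCount n + oddExtra (isEven n)) + oddExtra (not (isEven n))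
    ≡⟨ cong (λ x → 2 * x + oddExtra (isEven (suc n))) (sym (atNilCount-suc n)) ⟩
  2 * atNilCount (suc n) + oddExtra (isEven (suc n)) ∎
  where
  open ≡-Reasoning
  doubling : ∀ e A → 4 * A + periodicCount e ≡ 2 * (2 * A + oddExtra e) + oddExtra (not e)
  doubling true  = solve-∀
  doubling false = solve-∀

K≡4+S : ∀ n → K (suc (suc (suc n))) ≡ 4 + S (suc (suc (suc n)))
K≡4+S n = begin
  K (suc (suc (suc n)))
    ≡⟨ K-count (suc n) ⟩
  atNilCount (suc n) + periodicCount (not (isEven n))
    ≡⟨ cong (_+ periodicCount (not (isEven n))) (atNilCount-suc n) ⟩
  2 * atNilCount n + oddExtra (isEven n) + periodicCount (not (isEven n))
    ≡⟨ collect (isEven n) (atNilCount n) ⟩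
  4 + (atNilCount n + atNilCount n)
    ≡⟨ cong (λ x → 4 + x) (sym (S-count n)) ⟩
  4 + S (suc (suc (suc n))) ∎
  where
  open ≡-Reasoning
  collect : ∀ e A → 2 * A + oddExtra e + periodicCount (not e) ≡ 4 + (A + A)
  collect true  = solve-∀
  collect false = solve-∀

theorem7p11 : (n : ℕ) → 3 ≤ n → + S n ≡ + K n - + 4
theorem7p11 zero                ()
theorem7p11 (suc zero)          (s≤s ())
theorem7p11 (suc (suc zero))    (s≤s (s≤s ()))
theorem7p11 (suc (suc (suc n))) _ = sym (begin
  + K m - + 4              ≡⟨ cong (λ k → + k - + 4) (K≡4+S n) ⟩
  + (4 + S m) - + 4        ≡⟨ ℤP.[+m]-[+n]≡m⊖n (4 + S m) 4 ⟩
  (4 + S m) ℤ.⊖ (4 + 0)    ≡⟨ ℤP.+-cancelˡ-⊖ 4 (S m) 0 ⟩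
  S m ℤ.⊖ 0                ≡⟨ ℤP.⊖-≥ z≤n ⟩
  + S m                    ∎)
  where
  open ≡-Reasoning
  m = suc (suc (suc n))
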